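{- Let $m\ge 1$ and $1\le d\le 2m$. For every arrow $\mathcal Q\to\mathcal Q'$ of the digraph $\mathbf{SQ}(\langle 2m+1\rangle,d)$, either $red(\mathcal Q)=red(\mathcal Q')$ or there is an arrow $red(\mathcal Q)\to red(\mathcal Q')$ in the digraph $\mathbf{SQ}(\langle 2m\rangle,d)$.
   Context: Notation: $\langle 2m\rangle=\{ -m,\dots,-1,1,\dots,m\}$ and $\langle 2m+1\rangle=\{ -m,\dots,-1,0,1,\dots,m\}$, each with its natural order, and with color involution $i^\circ=-i$ (extended to subsets by $X^\circ=\{i^\circ:i\in X\}$). For a totally ordered finite color set $N$ with $|N|\ge d$, let $\xi_i\in\mathbb R^d$ ($i\in N$) be such that all $d\times d$ minors of the matrix with columns $\xi_i$ in increasing order of $i$ are positive; $Z(D,d)$ ($D\subseteq N$) is the Minkowski sum of the segments $[0,\xi_i]$, $i\in D$, and $Z(N,d)$ is the cyclic zonotope. A cubillage of $Z(N,d)$ is a subdivision into cubes, each a translate of $Z(D,d)$ with $|D|=d$ (its type), two intersecting cubes sharing a common face; each $d$-subset is the type of exactly one cube. $Gr(F,k)$ is the set of $k$-subsets of $F$. $S\subseteq Gr(N,d+1)$ is bi-convex if for each $F\subseteq N$ with $|F|=d+2$, $S\cap Gr(F,d+1)$ is an initial or final segment of $Gr(F,d+1)$ in lexicographic order. Each cubillage $\mathcal Q$ has an inversion set $Inv(\mathcal Q)\subseteq Gr(N,d+1)$ (types of cubes lying before the membrane representing $\mathcal Q$ in a cubillage of $Z(N,d+1)$, in direction $e_{d+1}$),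 and $\mathcal Q\mapsto Inv(\mathcal Q)$ is a bijection onto bi-convex sets; standard cubillage: $Inv=\emptyset$; anti-standard: $Inv=Gr(N,d+1)$. $\mathcal Q$ is symmetric if $Inv(\mathcal Q)^\circ=Inv(\mathcal Q)$. A capsid (resp. barrel) of type $F$, $|F|=d+1$ (resp. $d+2$), in $\mathcal Q$ is a set of cubes of $\mathcal Q$ whose union is a translate of $Z(F,d)$; its filling is standard/anti-standard if it corresponds to the standard/anti-standard cubillage of $Z(F,d)$. A raising flip replaces a standard filling by the anti-standard one, adding $F$ (capsid) resp. all of $Gr(F,d+1)$ (barrel) to the inversion set. The digraph $\mathbf{SQ}(N,d)$ has vertices the symmetric cubillages of $Z(N,d)$ and an arrow $\mathcal Q\to\mathcal Q'$ when $\mathcal Q'$ arises by a symmetric raising flip: (simple) in a standard capsid of type $K=K^\circ$; (double) simultaneously in two standard capsids of types $K\ne K^\circ$ with no common cube; (barrel) in a standard barrel of type $F=F^\circ$. The reduction map $red:\mathbf{SQ}(\langle 2m+1\rangle,d)\to\mathbf{SQ}(\langle 2m\rangle,d)$ sends $\mathcal Q$ to the symmetric cubillage $red(\mathcal Q)$ of $Z(\langle 2m\rangle,d)$ with $Inv(red(\mathcal Q))=Inv(\mathcal Q)\cap Gr(\langle 2m\rangle,d+1)$ (geometrically: contracting the cubes containing color $0$ in the direction $\xi_0$). -}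

module Defs where

open import Data.Nat using (ℕ; zero; suc; _+_)
open import Data.Bool using (Bool; true; false; not; _∧_; _∨_; _xor_)
open import Data.Fin using (Fin; opposite; _↑ˡ_; fromℕ) renaming (_<_ to _<ᶠ_)
open import Data.Fin.Subset using (Subset; _∈_; _∉_; _⊆_; _∩_; _∪_; _-_; ∣_∣; ⁅_⁆; Empty)
open import Data.Fin.Properties using () renaming (_<?_ to _<ᶠ?_)
open import Data.Vec using (Vec; tabulate; lookup; insertAt; replicate)
open import Data.Product using (Σ; _×_; _,_)
open import Data.Sum using (_⊎_)
open import Data.Empty using (⊥)
open import Relation.Binary.PropositionalEquality using (_≡_; _≢_)
open import Relation.Nullary using (¬_)
open import Relation.Nullary.Decidable using (does)

-- Colour sets are Fin n with their natural order.
--   ⟨2m+1⟩ = {-m..m}  is  Fin (suc (m + m)),  index k ↔ colour k - m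
--                      (so colour 0 is index m).
--   ⟨2m⟩   = {-m..-1,1..m} is Fin (m + m), index k ↔ k - m (k < m), k - m + 1 (k ≥ m).
-- In both cases the colour involution i ↦ -i is  opposite : Fin n → Fin n.

_° : ∀ {n} → Subset n → Subset n
_° {n} X = tabulate (λ i → lookup X (opposite i))

Gr : ∀ {n} → ℕ → Subset n → Set
Gr k X = ∣ X ∣ ≡ k

-- Lexicographic order on subsets of equal size (as increasing sequences):
-- X <lex Y iff the least element of the symmetric difference lies in X.
_<lex_ : ∀ {n} → Subset n → Subset n → Set
_<lex_ {n} X Y = Σ (Fin n) λ i → i ∈ X × i ∉ Y ×
                 (∀ (j : Fin n) → j <ᶠ i → lookup X j ≡ lookup Y j)

-- A (candidate) inversion set: a Boolean predicate on subsets of N;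
-- only its values on (d+1)-subsets are meaningful.
InvSet : ℕ → Set
InvSet n = Subset n → Bool

_≈[_]_ : ∀ {n} → InvSet n → ℕ → InvSet n → Set
_≈[_]_ {n} S d T = ∀ (X : Subset n) → Gr (suc d) X → S X ≡ T X

InitialIn : ∀ {n} → ℕ → InvSet n → Subset n → Set
InitialIn {n} d S F = ∀ (A B : Subset n) → A ⊆ F → B ⊆ F → Gr (suc d) A → Gr (suc d) B →
                      A <lex B → S B ≡ true → S A ≡ true

FinalIn : ∀ {n} → ℕ → InvSet n → Subset n → Set
FinalIn {n} d S F = ∀ (A B : Subset n) → A ⊆ F → B ⊆ F → Gr (suc d) A → Gr (suc d) B →
                    A <lex B → S A ≡ true → S B ≡ true

BiConvex : (n d : ℕ) → InvSet n → Set
BiConvex n d S = ∀ (F : Subset n) → Gr (suc (suc d)) F → InitialIn d S F ⊎ FinalIn d S F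

Symmetric : (n d : ℕ) → InvSet n → Set
Symmetric n d S = ∀ (X : Subset n) → Gr (suc d) X → S (X °) ≡ S X

-- Vertices of SQ(N,d): symmetric cubillages, identified (via Q ↦ Inv(Q))
-- with symmetric bi-convex subsets of Gr(N,d+1).
IsSymCub : (n d : ℕ) → InvSet n → Set
IsSymCub n d S = BiConvex n d S × Symmetric n d S

-- Combinatorial position of the unique cube of type D (|D| = d) of the
-- cubillage with inversion set S: the cube is the translate of Z(D,d) by
-- Σ_{i ∈ pos S D} ξ_i, where for i ∉ D,
--   i ∈ pos S D  iff  (#{j ∈ D : j > i} is odd) xor (D ∪ {i} ∈ S).
odd : ℕ → Bool
odd zero    = false
odd (suc k) = not (odd k)

above : ∀ {n} → Fin n → Subset n
above i = tabulate (λ j → does (i <ᶠ? j))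

pos : ∀ {n} → InvSet n → Subset n → Subset n
pos S D = tabulate (λ i → not (lookup D i) ∧ (odd ∣ D ∩ above i ∣ xor S (D ∪ ⁅ i ⁆)))

-- the standard cubillage (Inv = ∅)
∅Inv : ∀ {n} → InvSet n
∅Inv _ = false

Disjoint : ∀ {n} → Subset n → Subset n → Set
Disjoint X Y = Empty (X ∩ Y)

-- Q has a capsid of type K (|K| = d+1) with standard filling: the cubes of
-- types K - f (f ∈ K) together form a translate (by Σ_{Y} ξ) of Z(K,d), their
-- positions inside it being those of the standard cubillage of Z(K,d).
StdCapsid : ∀ {n} → InvSet n → Subset n → Set
StdCapsid {n} S K = Σ (Subset n) λ Y → Disjoint Y K ×
  (∀ (f : Fin n) → f ∈ K → pos S (K - f) ≡ Y ∪ (pos ∅Inv (K - f) ∩ K))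

StdBarrel : ∀ {n} → ℕ → InvSet n → Subset n → Set
StdBarrel {n} d S F = Σ (Subset n) λ Y → Disjoint Y F ×
  (∀ (D : Subset n) → D ⊆ F → Gr d D → pos S D ≡ Y ∪ (pos ∅Inv D ∩ F))

-- Two capsids of types K, K' (each consisting of the cubes of Q whose type is
-- a d-subset of it) have no common cube.
NoCommonCube : ∀ {n} → ℕ → Subset n → Subset n → Set
NoCommonCube {n} d K K' = ∀ (D : Subset n) → Gr d D → D ⊆ K → D ⊆ K' → ⊥

AddsTo : ∀ {n} → ℕ → InvSet n → (Subset n → Set) → InvSet n → Set
AddsTo {n} d S T S' = ∀ (X : Subset n) → Gr (suc d) X →
  ((S' X ≡ true) → (S X ≡ true) ⊎ T X) × ((S X ≡ true) ⊎ T X → S' X ≡ true)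

data Flip (n d : ℕ) (S S' : InvSet n) : Set where
  simple : (K : Subset n) → Gr (suc d) K → K ° ≡ K → StdCapsid S K →
           AddsTo d S (λ X → X ≡ K) S' → Flip n d S S'
  double : (K : Subset n) → Gr (suc d) K → K ° ≢ K →
           StdCapsid S K → StdCapsid S (K °) → NoCommonCube d K (K °) →
           AddsTo d S (λ X → X ≡ K ⊎ X ≡ K °) S' → Flip n d S S'
  barrel : (F : Subset n) → Gr (suc (suc d)) F → F ° ≡ F → StdBarrel d S F →
           AddsTo d S (λ X → X ⊆ F) S' → Flip n d S S'

SQArrow : (n d : ℕ) → InvSet n → InvSet n → Set
SQArrow n d S S' = IsSymCub n d S × IsSymCub n d S' × Flip n d S S'

-- Reduction ⟨2m+1⟩ → ⟨2m⟩:  Inv(red Q) = Inv(Q) ∩ Gr(⟨2m⟩, d+1), where a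
-- subset of ⟨2m⟩ is viewed as a subset of ⟨2m+1⟩ not containing colour 0
-- (index m).
embed : (m : ℕ) → Subset (m + m) → Subset (suc (m + m))
embed m X = insertAt X (fromℕ m ↑ˡ m) false

red : (m : ℕ) → InvSet (suc (m + m)) → InvSet (m + m)
red m S X = S (embed m X)

-- Write p for colour 0, the fixed point of the involution. Reduction restricts an
-- inversion set to the (d+1)-sets avoiding p, and deleting p commutes with the
-- lexicographic order, the involution, the positions of the cubes and the set operations
-- that define capsids, barrels and flips. So a flip whose type avoids p is, after
-- reduction, a flip of the same kind; a capsid flip of type K ∋ p only adds sets
-- containing p and becomes invisible; and a standard barrel of type F ∋ p yields a
-- standard capsid of type F - p in the reduced cubillage, whose flip is a simple flip.
module Submission where

open import Defs
open import Data.Nat using (ℕ; suc; _+_; _∸_; _≤_)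
open import Data.Nat.Properties using (suc-injective; ≰⇒>; <⇒≱; <-irrefl; ≤-<-trans; m+n∸n≡m)
open import Data.Bool using (Bool; true; false; not; _∧_; _xor_)
open import Data.Fin using (Fin; zero; suc; toℕ; fromℕ; inject₁; opposite; punchIn; punchOut; _↑ˡ_)
  renaming (_<_ to _<ᶠ_)
open import Data.Fin.Properties
  using (_≟_; punchIn-injective; punchInᵢ≢i; punchIn-mono-≤; punchIn-cancel-≤; punchIn-punchOut;
         toℕ-injective; opposite-prop; toℕ-↑ˡ; toℕ-fromℕ)
  renaming (_<?_ to _<ᶠ?_)
open import Data.Fin.Subset
  using (Subset; outside; inside; _∈_; _∉_; _⊆_; _∩_; _∪_; _─_; _-_; ∣_∣; ⁅_⁆)
open import Data.Fin.Subset.Properties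
  using (_∈?_; ⊆-antisym; ⊆-reflexive; p⊆q⇒∣p∣≤∣q∣; x∈p⇒∣p-x∣<∣p∣; x∈p∧x≢y⇒x∈p-y; x∈⁅x⁆;
         x∈⁅y⁆⇒x≡y; x≢y⇒x∉⁅y⁆; p─⊥≡p; p∩q⊆p; p─q⊆p; x∈p∪q⁻)
open import Data.Vec using (Vec; _∷_; here; there; tabulate; lookup; insertAt; removeAt; zipWith)
open import Data.Vec.Properties
  using (tabulate∘lookup; tabulate-cong; lookup∘tabulate; lookup-zipWith; insertAt-lookup;
         insertAt-punchIn; insertAt-removeAt; removeAt-insertAt; []=⇒lookup; lookup⇒[]=)
open import Data.Product using (_,_)
open import Data.Sum using (_⊎_; inj₁; inj₂; [_,_]) renaming (map to ⊎-map)
open import Data.Empty using (⊥-elim)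
open import Function using (_∘_; id)
open import Function.Bundles using (_⇔_; mk⇔; Equivalence)
open import Data.Sum.Function.Propositional using (_⊎-⇔_)
open import Relation.Binary.PropositionalEquality
  using (_≡_; _≢_; refl; sym; trans; cong; cong₂; subst; module ≡-Reasoning)
open import Relation.Nullary using (¬_; yes; no; does; contradiction)
open import Relation.Nullary.Decidable using (does-⇔)

open ≡-Reasoning

bool-ext : ∀ {a b : Bool} → (a ≡ true → b ≡ true) → (b ≡ true → a ≡ true) → a ≡ b
bool-ext {false} {false} _ _ = refl
bool-ext {false} {true}  _ g = g refl
bool-ext {true}  {false} f _ = sym (f refl)
bool-ext {true}  {true}  _ _ = refl

lookup-ext : ∀ {A : Set} {k} {xs ys : Vec A k} → (∀ i → lookup xs i ≡ lookup ys i) → xs ≡ ys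
lookup-ext {xs = xs} {ys} eq = begin
  xs                   ≡⟨ sym (tabulate∘lookup xs) ⟩
  tabulate (lookup xs) ≡⟨ tabulate-cong eq ⟩
  tabulate (lookup ys) ≡⟨ tabulate∘lookup ys ⟩
  ys                   ∎

lookup-removeAt : ∀ {A : Set} {k} (xs : Vec A (suc k)) i j →
                  lookup (removeAt xs i) j ≡ lookup xs (punchIn i j)
lookup-removeAt xs i j = begin
  lookup (removeAt xs i) j
    ≡⟨ sym (insertAt-punchIn (removeAt xs i) i (lookup xs i) j) ⟩
  lookup (insertAt (removeAt xs i) i (lookup xs i)) (punchIn i j)
    ≡⟨ cong (λ v → lookup v (punchIn i j)) (insertAt-removeAt xs i) ⟩
  lookup xs (punchIn i j)
    ∎

removeAt-zipWith : ∀ {A B C : Set} {k} (f : A → B → C) (xs : Vec A (suc k)) ys i →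
                   removeAt (zipWith f xs ys) i ≡ zipWith f (removeAt xs i) (removeAt ys i)
removeAt-zipWith f xs ys i = lookup-ext λ j → begin
  lookup (removeAt (zipWith f xs ys) i) j
    ≡⟨ lookup-removeAt (zipWith f xs ys) i j ⟩
  lookup (zipWith f xs ys) (punchIn i j)
    ≡⟨ lookup-zipWith f (punchIn i j) xs ys ⟩
  f (lookup xs (punchIn i j)) (lookup ys (punchIn i j))
    ≡⟨ sym (cong₂ f (lookup-removeAt xs i j) (lookup-removeAt ys i j)) ⟩
  f (lookup (removeAt xs i) j) (lookup (removeAt ys i) j)
    ≡⟨ sym (lookup-zipWith f j (removeAt xs i) (removeAt ys i)) ⟩
  lookup (zipWith f (removeAt xs i) (removeAt ys i)) j
    ∎

removeAt-tabulate : ∀ {A : Set} {k} (f : Fin (suc k) → A) i →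
                    removeAt (tabulate f) i ≡ tabulate (f ∘ punchIn i)
removeAt-tabulate f i = lookup-ext λ j →
  trans (lookup-removeAt (tabulate f) i j)
        (trans (lookup∘tabulate f (punchIn i j)) (sym (lookup∘tabulate (f ∘ punchIn i) j)))

punchIn-mono-< : ∀ {k} (i : Fin (suc k)) {j l : Fin k} → j <ᶠ l → punchIn i j <ᶠ punchIn i l
punchIn-mono-< i {j} {l} j<l = ≰⇒> (λ il≤ij → <⇒≱ j<l (punchIn-cancel-≤ i l j il≤ij))

punchIn-cancel-< : ∀ {k} (i : Fin (suc k)) {j l : Fin k} → punchIn i j <ᶠ punchIn i l → j <ᶠ l
punchIn-cancel-< i {j} {l} ij<il = ≰⇒> (λ l≤j → <⇒≱ ij<il (punchIn-mono-≤ i l j l≤j))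

punchIn-fromℕ : ∀ {k} (j : Fin k) → punchIn (fromℕ k) j ≡ inject₁ j
punchIn-fromℕ zero    = refl
punchIn-fromℕ (suc j) = cong suc (punchIn-fromℕ j)

punchIn-inject₁-fromℕ : ∀ {k} (i : Fin (suc k)) → punchIn (inject₁ i) (fromℕ k) ≡ fromℕ (suc k)
punchIn-inject₁-fromℕ           zero    = refl
punchIn-inject₁-fromℕ {suc k} (suc i) = cong suc (punchIn-inject₁-fromℕ i)

punchIn-inject₁ : ∀ {k} (i : Fin (suc k)) (j : Fin k) →
                  punchIn (inject₁ i) (inject₁ j) ≡ inject₁ (punchIn i j)
punchIn-inject₁ zero    j       = refl
punchIn-inject₁ (suc i) zero    = refl
punchIn-inject₁ (suc i) (suc j) = cong suc (punchIn-inject₁ i j)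

opposite-punchIn : ∀ {k} (i : Fin (suc k)) (j : Fin k) →
                   opposite (punchIn i j) ≡ punchIn (opposite i) (opposite j)
opposite-punchIn zero    j       = sym (punchIn-fromℕ (opposite j))
opposite-punchIn (suc i) zero    = sym (punchIn-inject₁-fromℕ (opposite i))
opposite-punchIn (suc i) (suc j) =
  trans (cong inject₁ (opposite-punchIn i j)) (sym (punchIn-inject₁ (opposite i) (opposite j)))

x∉p⇒lookup≡outside : ∀ {k} {p : Subset k} {x} → x ∉ p → lookup p x ≡ outside
x∉p⇒lookup≡outside {p = p} {x} x∉p with lookup p x in eq
... | outside = refl
... | inside  = contradiction (lookup⇒[]= x p eq) x∉p

∣insertAt-outside∣ : ∀ {k} (p : Subset k) i → ∣ insertAt p i outside ∣ ≡ ∣ p ∣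
∣insertAt-outside∣ p             zero    = refl
∣insertAt-outside∣ (outside ∷ p) (suc i) = ∣insertAt-outside∣ p i
∣insertAt-outside∣ (inside ∷ p)  (suc i) = cong suc (∣insertAt-outside∣ p i)

∣insertAt-inside∣ : ∀ {k} (p : Subset k) i → ∣ insertAt p i inside ∣ ≡ suc ∣ p ∣
∣insertAt-inside∣ p             zero    = refl
∣insertAt-inside∣ (outside ∷ p) (suc i) = ∣insertAt-inside∣ p i
∣insertAt-inside∣ (inside ∷ p)  (suc i) = cong suc (∣insertAt-inside∣ p i)

suc∣p-x∣≡∣p∣ : ∀ {k} {p : Subset k} {x} → x ∈ p → suc ∣ p - x ∣ ≡ ∣ p ∣
suc∣p-x∣≡∣p∣ {p = inside ∷ p}  here        = cong (suc ∘ ∣_∣) (p─⊥≡p p)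
suc∣p-x∣≡∣p∣ {p = outside ∷ p} (there x∈p) = suc∣p-x∣≡∣p∣ x∈p
suc∣p-x∣≡∣p∣ {p = inside ∷ p}  (there x∈p) = cong suc (suc∣p-x∣≡∣p∣ x∈p)

p⊆q⇒∣p∣≡∣q∣⇒p≡q : ∀ {k} {p q : Subset k} → p ⊆ q → ∣ p ∣ ≡ ∣ q ∣ → p ≡ q
p⊆q⇒∣p∣≡∣q∣⇒p≡q {p = p} {q} p⊆q ∣p∣≡∣q∣ = ⊆-antisym p⊆q q⊆p
  where
  q⊆p : q ⊆ p
  q⊆p {x} x∈q with x ∈? p
  ... | yes x∈p = x∈p
  ... | no  x∉p = ⊥-elim (<-irrefl ∣p∣≡∣q∣ (≤-<-trans (p⊆q⇒∣p∣≤∣q∣ p⊆q-x) (x∈p⇒∣p-x∣<∣p∣ x∈q)))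
    where
    p⊆q-x : p ⊆ q - x
    p⊆q-x {y} y∈p = x∈p∧x≢y⇒x∈p-y (p⊆q y∈p) (λ { refl → x∉p y∈p })

lookup-° : ∀ {k} (X : Subset k) i → lookup (X °) i ≡ lookup X (opposite i)
lookup-° X = lookup∘tabulate (lookup X ∘ opposite)

AddsTo-cong : ∀ {k} d {S S' : InvSet k} {T T'} → AddsTo d S T S' →
              (∀ X → Gr (suc d) X → T X ⇔ T' X) → AddsTo d S T' S'
AddsTo-cong d adds T⇔T' X ∣X∣ with adds X ∣X∣
... | new⇒old , old⇒new = ⊎-map id to ∘ new⇒old , old⇒new ∘ ⊎-map id from
  where open Equivalence (T⇔T' X ∣X∣)

AddsTo-nothing : ∀ {k} d {S S' : InvSet k} {T} → AddsTo d S T S' →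
                 (∀ X → Gr (suc d) X → ¬ T X) → S ≈[ d ] S'
AddsTo-nothing d {S} adds ¬T X ∣X∣ with adds X ∣X∣
... | new⇒old , old⇒new = bool-ext (old⇒new ∘ inj₁) (λ new → old (new⇒old new))
  where
  old : S X ≡ true ⊎ _ → S X ≡ true
  old (inj₁ old) = old
  old (inj₂ t)   = contradiction t (¬T X ∣X∣)

module Deletion {n : ℕ} (p : Fin (suc n)) where

  ι : Subset n → Subset (suc n)
  ι X = insertAt X p outside

  ρ : Subset (suc n) → Subset n
  ρ X = removeAt X p

  restrict : InvSet (suc n) → InvSet n
  restrict S X = S (ι X)

  data Punched : Fin (suc n) → Set where
    at-p    : Punched p
    punched : (j : Fin n) → Punched (punchIn p j)

  punched? : ∀ i → Punched i
  punched? i with p ≟ i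
  ... | yes refl = at-p
  ... | no  p≢i  = subst Punched (punchIn-punchOut p≢i) (punched (punchOut p≢i))

  ρ-ι : ∀ X → ρ (ι X) ≡ X
  ρ-ι X = removeAt-insertAt X p outside

  ι-injective : ∀ {X Y} → ι X ≡ ι Y → X ≡ Y
  ι-injective {X} {Y} eq = trans (sym (ρ-ι X)) (trans (cong ρ eq) (ρ-ι Y))

  ι-ρ : ∀ {Z} → p ∉ Z → ι (ρ Z) ≡ Z
  ι-ρ {Z} p∉Z = subst (λ b → insertAt (ρ Z) p b ≡ Z) (x∉p⇒lookup≡outside p∉Z) (insertAt-removeAt Z p)

  ι-unique : ∀ {X Z} → p ∉ Z → ρ Z ≡ X → ι X ≡ Z
  ι-unique p∉Z refl = ι-ρ p∉Z

  p∉ι : ∀ X → p ∉ ι X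
  p∉ι X p∈ιX with trans (sym (insertAt-lookup X p outside)) ([]=⇒lookup p∈ιX)
  ... | ()

  ∈ι⁺ : ∀ {X j} → j ∈ X → punchIn p j ∈ ι X
  ∈ι⁺ {X} {j} j∈X = lookup⇒[]= _ (ι X) (trans (insertAt-punchIn X p outside j) ([]=⇒lookup j∈X))

  ∈ι⁻ : ∀ {X j} → punchIn p j ∈ ι X → j ∈ X
  ∈ι⁻ {X} {j} pj∈ιX = lookup⇒[]= j X (trans (sym (insertAt-punchIn X p outside j)) ([]=⇒lookup pj∈ιX))

  ∈ρ⁺ : ∀ {Z j} → punchIn p j ∈ Z → j ∈ ρ Z
  ∈ρ⁺ {Z} {j} pj∈Z = lookup⇒[]= j (ρ Z) (trans (lookup-removeAt Z p j) ([]=⇒lookup pj∈Z))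

  ∈ρ⁻ : ∀ {Z j} → j ∈ ρ Z → punchIn p j ∈ Z
  ∈ρ⁻ {Z} {j} j∈ρZ = lookup⇒[]= _ Z (trans (sym (lookup-removeAt Z p j)) ([]=⇒lookup j∈ρZ))

  ι⊆⇒⊆ρ : ∀ {X Z} → ι X ⊆ Z → X ⊆ ρ Z
  ι⊆⇒⊆ρ ιX⊆Z j∈X = ∈ρ⁺ (ιX⊆Z (∈ι⁺ j∈X))

  ⊆ρ⇒ι⊆ : ∀ {X Z} → X ⊆ ρ Z → ι X ⊆ Z
  ⊆ρ⇒ι⊆ {X} X⊆ρZ {i} i∈ιX with punched? i
  ... | at-p      = contradiction i∈ιX (p∉ι X)
  ... | punched j = ∈ρ⁻ (X⊆ρZ (∈ι⁻ i∈ιX))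

  ι-mono : ∀ {X Y} → X ⊆ Y → ι X ⊆ ι Y
  ι-mono {X} {Y} X⊆Y = ⊆ρ⇒ι⊆ (subst (X ⊆_) (sym (ρ-ι Y)) X⊆Y)

  ι-cancel-⊆ : ∀ {X Y} → ι X ⊆ ι Y → X ⊆ Y
  ι-cancel-⊆ {X} {Y} ιX⊆ιY = subst (X ⊆_) (ρ-ι Y) (ι⊆⇒⊆ρ ιX⊆ιY)

  ∣ι∣ : ∀ X → ∣ ι X ∣ ≡ ∣ X ∣
  ∣ι∣ X = ∣insertAt-outside∣ X p

  Gr-ι⁺ : ∀ {k X} → Gr k X → Gr k (ι X)
  Gr-ι⁺ {X = X} ∣X∣ = trans (∣ι∣ X) ∣X∣

  Gr-ι⁻ : ∀ {k X} → Gr k (ι X) → Gr k X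
  Gr-ι⁻ {X = X} ∣ιX∣ = trans (sym (∣ι∣ X)) ∣ιX∣

  suc∣ρ∣ : ∀ {F} → p ∈ F → suc ∣ ρ F ∣ ≡ ∣ F ∣
  suc∣ρ∣ {F} p∈F = begin
    suc ∣ ρ F ∣                       ≡⟨ sym (∣insertAt-inside∣ (ρ F) p) ⟩
    ∣ insertAt (ρ F) p inside ∣       ≡⟨ cong (λ b → ∣ insertAt (ρ F) p b ∣) (sym ([]=⇒lookup p∈F)) ⟩
    ∣ insertAt (ρ F) p (lookup F p) ∣ ≡⟨ cong ∣_∣ (insertAt-removeAt F p) ⟩
    ∣ F ∣                             ∎

  ∣ρ∣ : ∀ {F k} → p ∈ F → Gr (suc k) F → Gr k (ρ F)
  ∣ρ∣ p∈F ∣F∣ = suc-injective (trans (suc∣ρ∣ p∈F) ∣F∣)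

  ι-<lex : ∀ {A B} → A <lex B → ι A <lex ι B
  ι-<lex {A} {B} (i , i∈A , i∉B , agree) = punchIn p i , ∈ι⁺ i∈A , i∉B ∘ ∈ι⁻ , agree′
    where
    agree′ : ∀ j → j <ᶠ punchIn p i → lookup (ι A) j ≡ lookup (ι B) j
    agree′ j j<pi with punched? j
    ... | at-p      = trans (insertAt-lookup A p outside) (sym (insertAt-lookup B p outside))
    ... | punched k = begin
      lookup (ι A) (punchIn p k) ≡⟨ insertAt-punchIn A p outside k ⟩
      lookup A k                 ≡⟨ agree k (punchIn-cancel-< p j<pi) ⟩
      lookup B k                 ≡⟨ sym (insertAt-punchIn B p outside k) ⟩
      lookup (ι B) (punchIn p k) ∎

  restrict-InitialIn : ∀ d {S F} → InitialIn d S (ι F) → InitialIn d (restrict S) F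
  restrict-InitialIn d initial A B A⊆F B⊆F ∣A∣ ∣B∣ A<B =
    initial (ι A) (ι B) (ι-mono A⊆F) (ι-mono B⊆F) (Gr-ι⁺ ∣A∣) (Gr-ι⁺ ∣B∣) (ι-<lex A<B)

  restrict-FinalIn : ∀ d {S F} → FinalIn d S (ι F) → FinalIn d (restrict S) F
  restrict-FinalIn d final A B A⊆F B⊆F ∣A∣ ∣B∣ A<B =
    final (ι A) (ι B) (ι-mono A⊆F) (ι-mono B⊆F) (Gr-ι⁺ ∣A∣) (Gr-ι⁺ ∣B∣) (ι-<lex A<B)

  restrict-BiConvex : ∀ d {S} → BiConvex (suc n) d S → BiConvex n d (restrict S)
  restrict-BiConvex d biconvex F ∣F∣ =
    ⊎-map (restrict-InitialIn d) (restrict-FinalIn d) (biconvex (ι F) (Gr-ι⁺ ∣F∣))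

  restrict-AddsTo : ∀ d {S S' T} → AddsTo d S T S' → AddsTo d (restrict S) (T ∘ ι) (restrict S')
  restrict-AddsTo d adds X ∣X∣ = adds (ι X) (Gr-ι⁺ ∣X∣)

  ρ-∪ : ∀ Y Z → ρ (Y ∪ Z) ≡ ρ Y ∪ ρ Z
  ρ-∪ Y Z = removeAt-zipWith _ Y Z p

  ρ-∩ : ∀ Y Z → ρ (Y ∩ Z) ≡ ρ Y ∩ ρ Z
  ρ-∩ Y Z = removeAt-zipWith _ Y Z p

  ρ-─ : ∀ Y Z → ρ (Y ─ Z) ≡ ρ Y ─ ρ Z
  ρ-─ Y Z = removeAt-zipWith _ Y Z p

  ρ-⁅punchIn⁆ : ∀ j → ρ ⁅ punchIn p j ⁆ ≡ ⁅ j ⁆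
  ρ-⁅punchIn⁆ j = ⊆-antisym ⊆⁅j⁆ ⁅j⁆⊆
    where
    ⊆⁅j⁆ : ρ ⁅ punchIn p j ⁆ ⊆ ⁅ j ⁆
    ⊆⁅j⁆ {k} k∈ = subst (_∈ ⁅ j ⁆) (sym (punchIn-injective p k j (x∈⁅y⁆⇒x≡y _ (∈ρ⁻ k∈)))) (x∈⁅x⁆ j)
    ⁅j⁆⊆ : ⁅ j ⁆ ⊆ ρ ⁅ punchIn p j ⁆
    ⁅j⁆⊆ {k} k∈ = subst (_∈ ρ ⁅ punchIn p j ⁆) (sym (x∈⁅y⁆⇒x≡y j k∈)) (∈ρ⁺ (x∈⁅x⁆ (punchIn p j)))

  ρ-above : ∀ j → ρ (above (punchIn p j)) ≡ above j
  ρ-above j = trans (removeAt-tabulate (λ k → does (punchIn p j <ᶠ? k)) p) (tabulate-cong λ k →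
    does-⇔ (mk⇔ (punchIn-cancel-< p) (punchIn-mono-< p)) (punchIn p j <ᶠ? punchIn p k) (j <ᶠ? k))

  ι-∩ : ∀ D Z → ι D ∩ Z ≡ ι (D ∩ ρ Z)
  ι-∩ D Z = sym (ι-unique (p∉ι D ∘ p∩q⊆p (ι D) Z) (trans (ρ-∩ (ι D) Z) (cong (_∩ ρ Z) (ρ-ι D))))

  ι-─ : ∀ D Z → ι D ─ Z ≡ ι (D ─ ρ Z)
  ι-─ D Z = sym (ι-unique (p∉ι D ∘ p─q⊆p (ι D) Z) (trans (ρ-─ (ι D) Z) (cong (_─ ρ Z) (ρ-ι D))))

  ι-∪ : ∀ D {Z} → p ∉ Z → ι D ∪ Z ≡ ι (D ∪ ρ Z)
  ι-∪ D {Z} p∉Z = sym (ι-unique p∉ι-∪ (trans (ρ-∪ (ι D) Z) (cong (_∪ ρ Z) (ρ-ι D))))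
    where
    p∉ι-∪ : p ∉ ι D ∪ Z
    p∉ι-∪ p∈ with x∈p∪q⁻ (ι D) Z p∈
    ... | inj₁ p∈ιD = p∉ι D p∈ιD
    ... | inj₂ p∈Z  = p∉Z p∈Z

  ι-minus : ∀ K f → ι K - punchIn p f ≡ ι (K - f)
  ι-minus K f = trans (ι-─ K ⁅ punchIn p f ⁆) (cong (λ Z → ι (K ─ Z)) (ρ-⁅punchIn⁆ f))

  ι-∪-⁅⁆ : ∀ D j → ι D ∪ ⁅ punchIn p j ⁆ ≡ ι (D ∪ ⁅ j ⁆)
  ι-∪-⁅⁆ D j = trans (ι-∪ D (x≢y⇒x∉⁅y⁆ (punchInᵢ≢i p j ∘ sym))) (cong (λ Z → ι (D ∪ Z)) (ρ-⁅punchIn⁆ j))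

  ∣ι∩above∣ : ∀ D j → ∣ ι D ∩ above (punchIn p j) ∣ ≡ ∣ D ∩ above j ∣
  ∣ι∩above∣ D j = begin
    ∣ ι D ∩ above (punchIn p j) ∣         ≡⟨ cong ∣_∣ (ι-∩ D (above (punchIn p j))) ⟩
    ∣ ι (D ∩ ρ (above (punchIn p j))) ∣   ≡⟨ ∣ι∣ _ ⟩
    ∣ D ∩ ρ (above (punchIn p j)) ∣       ≡⟨ cong (λ Z → ∣ D ∩ Z ∣) (ρ-above j) ⟩
    ∣ D ∩ above j ∣                       ∎

  ρ-pos : ∀ S D → ρ (pos S (ι D)) ≡ pos (restrict S) D
  ρ-pos S D = trans (removeAt-tabulate position p) (tabulate-cong λ j →
    cong₂ (λ a b → not a ∧ b) (insertAt-punchIn D p outside j)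
          (cong₂ (λ c E → odd c xor S E) (∣ι∩above∣ D j) (ι-∪-⁅⁆ D j)))
    where
    position : Fin (suc n) → Bool
    position i = not (lookup (ι D) i) ∧ (odd ∣ ι D ∩ above i ∣ xor S (ι D ∪ ⁅ i ⁆))

  ρ-filling : ∀ S D Y G → pos S (ι D) ≡ Y ∪ (pos ∅Inv (ι D) ∩ G) →
              pos (restrict S) D ≡ ρ Y ∪ (pos ∅Inv D ∩ ρ G)
  ρ-filling S D Y G filling = begin
    pos (restrict S) D                 ≡⟨ sym (ρ-pos S D) ⟩
    ρ (pos S (ι D))                    ≡⟨ cong ρ filling ⟩
    ρ (Y ∪ (pos ∅Inv (ι D) ∩ G))       ≡⟨ ρ-∪ Y (pos ∅Inv (ι D) ∩ G) ⟩
    ρ Y ∪ ρ (pos ∅Inv (ι D) ∩ G)       ≡⟨ cong (ρ Y ∪_) (ρ-∩ (pos ∅Inv (ι D)) G) ⟩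
    ρ Y ∪ (ρ (pos ∅Inv (ι D)) ∩ ρ G)   ≡⟨ cong (λ P → ρ Y ∪ (P ∩ ρ G)) (ρ-pos ∅Inv D) ⟩
    ρ Y ∪ (pos ∅Inv D ∩ ρ G)           ∎

  ρ-Disjoint : ∀ {Y Z} → Disjoint Y Z → Disjoint (ρ Y) (ρ Z)
  ρ-Disjoint {Y} {Z} disjoint (j , j∈) = disjoint (punchIn p j , ∈ρ⁻ (subst (j ∈_) (sym (ρ-∩ Y Z)) j∈))

  restrict-StdCapsid : ∀ S {K} → StdCapsid S (ι K) → StdCapsid (restrict S) K
  restrict-StdCapsid S {K} (Y , disjoint , filling) =
    ρ Y , subst (Disjoint (ρ Y)) (ρ-ι K) (ρ-Disjoint disjoint) , filling′
    where
    filling′ : ∀ f → f ∈ K → pos (restrict S) (K - f) ≡ ρ Y ∪ (pos ∅Inv (K - f) ∩ K)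
    filling′ f f∈K =
      subst (λ G → pos (restrict S) (K - f) ≡ ρ Y ∪ (pos ∅Inv (K - f) ∩ G)) (ρ-ι K)
        (ρ-filling S (K - f) Y (ι K)
          (subst (λ Z → pos S Z ≡ Y ∪ (pos ∅Inv Z ∩ ι K)) (ι-minus K f)
                 (filling (punchIn p f) (∈ι⁺ f∈K))))

  restrict-StdBarrel : ∀ d S {F} → StdBarrel d S (ι F) → StdBarrel d (restrict S) F
  restrict-StdBarrel d S {F} (Y , disjoint , filling) =
    ρ Y , subst (Disjoint (ρ Y)) (ρ-ι F) (ρ-Disjoint disjoint) , λ D D⊆F ∣D∣ →
      subst (λ G → pos (restrict S) D ≡ ρ Y ∪ (pos ∅Inv D ∩ G)) (ρ-ι F)
        (ρ-filling S D Y (ι F) (filling (ι D) (ι-mono D⊆F) (Gr-ι⁺ ∣D∣)))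

  StdBarrel⇒restrict-StdCapsid : ∀ d S {F} → p ∈ F → Gr (suc (suc d)) F → StdBarrel d S F →
                                 StdCapsid (restrict S) (ρ F)
  StdBarrel⇒restrict-StdCapsid d S {F} p∈F ∣F∣ (Y , disjoint , filling) =
    ρ Y , ρ-Disjoint disjoint , λ f f∈ρF →
      ρ-filling S (ρ F - f) Y F (filling (ι (ρ F - f)) (⊆ρ⇒ι⊆ (p─q⊆p (ρ F) ⁅ f ⁆)) (∣ιρF-f∣ f∈ρF))
    where
    ∣ιρF-f∣ : ∀ {f} → f ∈ ρ F → Gr d (ι (ρ F - f))
    ∣ιρF-f∣ f∈ρF = Gr-ι⁺ (suc-injective (trans (suc∣p-x∣≡∣p∣ f∈ρF) (∣ρ∣ p∈F ∣F∣)))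

  ι≡ι⇔≡ : ∀ {X K} → ι X ≡ ι K ⇔ X ≡ K
  ι≡ι⇔≡ = mk⇔ ι-injective (cong ι)

  ι⊆ι⇔⊆ : ∀ {X Y} → ι X ⊆ ι Y ⇔ X ⊆ Y
  ι⊆ι⇔⊆ = mk⇔ ι-cancel-⊆ ι-mono

  ι⊆⇔≡ρ : ∀ {X F k} → p ∈ F → Gr (suc k) F → Gr k X → ι X ⊆ F ⇔ X ≡ ρ F
  ι⊆⇔≡ρ {X} {F} p∈F ∣F∣ ∣X∣ = mk⇔ ≡ρ λ X≡ρF → ⊆ρ⇒ι⊆ (⊆-reflexive X≡ρF)
    where
    ≡ρ : ι X ⊆ F → X ≡ ρ F
    ≡ρ ιX⊆F = p⊆q⇒∣p∣≡∣q∣⇒p≡q (ι⊆⇒⊆ρ ιX⊆F) (trans ∣X∣ (sym (∣ρ∣ p∈F ∣F∣)))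

  ι≢∋p : ∀ {X K} → p ∈ K → ι X ≢ K
  ι≢∋p {X} p∈K ιX≡K = p∉ι X (subst (p ∈_) (sym ιX≡K) p∈K)

  data ι-View : Subset (suc n) → Set where
    ∋p      : ∀ {K} → p ∈ K → ι-View K
    ι-image : ∀ K → ι-View (ι K)

  ι-view : ∀ K → ι-View K
  ι-view K with p ∈? K
  ... | yes p∈K = ∋p p∈K
  ... | no  p∉K = subst ι-View (ι-ρ p∉K) (ι-image (ρ K))

  module SelfOpposite (opposite-p : opposite p ≡ p) where

    opposite-punchIn-p : ∀ j → opposite (punchIn p j) ≡ punchIn p (opposite j)
    opposite-punchIn-p j = trans (opposite-punchIn p j) (cong (λ q → punchIn q (opposite j)) opposite-p)

    lookup-°-p : ∀ K → lookup (K °) p ≡ lookup K p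
    lookup-°-p K = trans (lookup-° K p) (cong (lookup K) opposite-p)

    p∈⇒p∈° : ∀ {K} → p ∈ K → p ∈ K °
    p∈⇒p∈° {K} p∈K = lookup⇒[]= p (K °) (trans (lookup-°-p K) ([]=⇒lookup p∈K))

    p∈°⇒p∈ : ∀ {K} → p ∈ K ° → p ∈ K
    p∈°⇒p∈ {K} p∈K° = lookup⇒[]= p K (trans (sym (lookup-°-p K)) ([]=⇒lookup p∈K°))

    ρ-° : ∀ X → ρ (X °) ≡ (ρ X) °
    ρ-° X = trans (removeAt-tabulate (lookup X ∘ opposite) p) (tabulate-cong λ j →
      trans (cong (lookup X) (opposite-punchIn-p j)) (sym (lookup-removeAt X p (opposite j))))

    ι-° : ∀ X → ι (X °) ≡ (ι X) °
    ι-° X = ι-unique (p∉ι X ∘ p∈°⇒p∈) (trans (ρ-° (ι X)) (cong _° (ρ-ι X)))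

    restrict-Symmetric : ∀ d {S} → Symmetric (suc n) d S → Symmetric n d (restrict S)
    restrict-Symmetric d {S} symmetric X ∣X∣ = trans (cong S (ι-° X)) (symmetric (ι X) (Gr-ι⁺ ∣X∣))

    restrict-IsSymCub : ∀ d {S} → IsSymCub (suc n) d S → IsSymCub n d (restrict S)
    restrict-IsSymCub d (biconvex , symmetric) =
      restrict-BiConvex d biconvex , restrict-Symmetric d symmetric

    °-fixed-ι⇔ : ∀ {K} → (ι K) ° ≡ ι K ⇔ K ° ≡ K
    °-fixed-ι⇔ {K} =
      mk⇔ (λ eq → ι-injective (trans (ι-° K) eq)) (λ eq → trans (sym (ι-° K)) (cong ι eq))

    ι≡ι°⇔≡° : ∀ {X K} → ι X ≡ (ι K) ° ⇔ X ≡ K °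
    ι≡ι°⇔≡° {K = K} =
      mk⇔ (λ eq → ι-injective (trans eq (sym (ι-° K)))) (λ eq → trans (cong ι eq) (ι-° K))

    ι-NoCommonCube : ∀ d {K} → NoCommonCube d (ι K) ((ι K) °) → NoCommonCube d K (K °)
    ι-NoCommonCube d {K} no-common D ∣D∣ D⊆K D⊆K° =
      no-common (ι D) (Gr-ι⁺ ∣D∣) (ι-mono D⊆K) (subst (ι D ⊆_) (ι-° K) (ι-mono D⊆K°))

    restrict-Flip : ∀ d {S S'} → Flip (suc n) d S S' →
                    (restrict S ≈[ d ] restrict S') ⊎ Flip n d (restrict S) (restrict S')
    restrict-Flip d {S} (simple K ∣K∣ K°≡K capsid adds) with ι-view K
    ... | ∋p p∈K = inj₁ (AddsTo-nothing d (restrict-AddsTo d adds) λ X _ → ι≢∋p p∈K)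
    ... | ι-image K₀ =
      inj₂ (simple K₀ (Gr-ι⁻ ∣K∣) (Equivalence.to °-fixed-ι⇔ K°≡K)
                   (restrict-StdCapsid S capsid)
                   (AddsTo-cong d (restrict-AddsTo d adds) λ X _ → ι≡ι⇔≡))
    restrict-Flip d {S} (double K ∣K∣ K°≢K capsid capsid° no-common adds) with ι-view K
    ... | ∋p p∈K = inj₁ (AddsTo-nothing d (restrict-AddsTo d adds) λ X _ →
                           [ ι≢∋p p∈K , ι≢∋p (p∈⇒p∈° p∈K) ])
    ... | ι-image K₀ =
      inj₂ (double K₀ (Gr-ι⁻ ∣K∣) (K°≢K ∘ Equivalence.from °-fixed-ι⇔)
                   (restrict-StdCapsid S capsid)
                   (restrict-StdCapsid S (subst (StdCapsid S) (sym (ι-° K₀)) capsid°))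
                   (ι-NoCommonCube d no-common)
                   (AddsTo-cong d (restrict-AddsTo d adds) λ X _ → ι≡ι⇔≡ ⊎-⇔ ι≡ι°⇔≡°))
    restrict-Flip d {S} (barrel F ∣F∣ F°≡F barrel′ adds) with ι-view F
    ... | ∋p p∈F =
      inj₂ (simple (ρ F) (∣ρ∣ p∈F ∣F∣) (trans (sym (ρ-° F)) (cong ρ F°≡F))
                   (StdBarrel⇒restrict-StdCapsid d S p∈F ∣F∣ barrel′)
                   (AddsTo-cong d (restrict-AddsTo d adds) λ X ∣X∣ → ι⊆⇔≡ρ p∈F ∣F∣ ∣X∣))
    ... | ι-image F₀ =
      inj₂ (barrel F₀ (Gr-ι⁻ ∣F∣) (Equivalence.to °-fixed-ι⇔ F°≡F)
                   (restrict-StdBarrel d S barrel′)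
                   (AddsTo-cong d (restrict-AddsTo d adds) λ X _ → ι⊆ι⇔⊆))

    restrict-SQArrow : ∀ d {S S'} → SQArrow (suc n) d S S' →
                       (restrict S ≈[ d ] restrict S') ⊎ SQArrow n d (restrict S) (restrict S')
    restrict-SQArrow d (cub , cub' , flip) =
      ⊎-map id (λ flip′ → restrict-IsSymCub d cub , restrict-IsSymCub d cub' , flip′)
               (restrict-Flip d flip)

-- The index of colour 0 in ⟨2m+1⟩; with p = midpoint m, Deletion.restrict is Defs.red m.
midpoint : ∀ m → Fin (suc (m + m))
midpoint m = fromℕ m ↑ˡ m

opposite-midpoint : ∀ m → opposite (midpoint m) ≡ midpoint m
opposite-midpoint m = toℕ-injective (begin
  toℕ (opposite (midpoint m)) ≡⟨ opposite-prop (midpoint m) ⟩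
  m + m ∸ toℕ (midpoint m)    ≡⟨ cong (m + m ∸_) toℕ-midpoint ⟩
  m + m ∸ m                   ≡⟨ m+n∸n≡m m m ⟩
  m                           ≡⟨ sym toℕ-midpoint ⟩
  toℕ (midpoint m)            ∎)
  where
  toℕ-midpoint : toℕ (midpoint m) ≡ m
  toℕ-midpoint = trans (toℕ-↑ˡ (fromℕ m) m) (toℕ-fromℕ m)

proposition4 : (m d : ℕ) → 1 ≤ m → 1 ≤ d → d ≤ m + m →
    (S S' : InvSet (suc (m + m))) →
    SQArrow (suc (m + m)) d S S' →
    (red m S ≈[ d ] red m S') ⊎ SQArrow (m + m) d (red m S) (red m S')
proposition4 m d _ _ _ S S' = restrict-SQArrow d
  where open Deletion (midpoint m)
        open SelfOpposite (opposite-midpoint m)
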